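{- Let $D$ be the set of Dyck numbers and for $n\ge1$ let $E_n=\{t\in D:\ 2^{n-1}\le t\le 2^n-1\}$. For every even $n\ge 6$, let $\mu_n=D\cap\bigl(2^{n-1}-1,\ 2^{n-1}-1+2^{n-3}\bigr]$ (the initial quarter of the level $E_n$). Then $$\#\mu_n=\#E_{n-2}-\mathrm{Cat}(n/2-1),$$ where $\mathrm{Cat}(m)=\frac{1}{m+1}\binom{2m}{m}$ is the $m$-th Catalan number.
   Context: A Dyck number is a nonnegative integer $t$ such that every suffix of the binary representation of $t$ (i.e. every block of least significant bits) contains at least as many 1's as 0's; these form OEIS A036991: $0,1,3,5,7,11,13,15,19,21,\dots$. -}

module Defs where

open import Data.Nat using (ℕ; zero; suc; _+_; _*_; _∸_; _^_; _≤_; _<_; _≤?_; _/_; _%_)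
open import Data.Nat.Combinatorics using (_C_)
open import Data.List using (List; []; _∷_; upTo; filter; length; map)
open import Data.Nat.ListAction using (sum)
open import Data.List.Relation.Unary.All using (All; all?)
open import Relation.Nullary using (Dec)
open import Relation.Unary using (Decidable)

bit : ℕ → ℕ → ℕ
bit t zero    = t % 2
bit t (suc k) = bit (t / 2) k

ones : ℕ → ℕ → ℕ
ones t k = sum (map (bit t) (upTo k))

zeros : ℕ → ℕ → ℕ
zeros t k = k ∸ ones t k

-- number of binary digits of t (bitLength 0 = 0: empty representation)
-- computed with fuel t, which suffices since bitLength t ≤ t
bitLengthF : ℕ → ℕ → ℕ
bitLengthF zero    t = zero
bitLengthF (suc f) zero = zero
bitLengthF (suc f) t@(suc _) = suc (bitLengthF f (t / 2))

bitLength : ℕ → ℕ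
bitLength t = bitLengthF t t

-- a Dyck number: every suffix (block of k least significant bits,
-- 0 ≤ k ≤ bitLength t) of the binary representation has at least
-- as many 1's as 0's
Dyck : ℕ → Set
Dyck t = All (λ k → zeros t k ≤ ones t k) (upTo (suc (bitLength t)))

dyck? : Decidable Dyck
dyck? t = all? (λ k → zeros t k ≤? ones t k) (upTo (suc (bitLength t)))

interval : ℕ → ℕ → List ℕ
interval a b = map (λ i → suc a + i) (upTo (b ∸ a))

countDyck : ℕ → ℕ → ℕ
countDyck a b = length (filter dyck? (interval a b))

#E : ℕ → ℕ
#E n = countDyck (2 ^ (n ∸ 1) ∸ 1) (2 ^ n ∸ 1)

#μ : ℕ → ℕ
#μ n = countDyck (2 ^ (n ∸ 1) ∸ 1) (2 ^ (n ∸ 1) ∸ 1 + 2 ^ (n ∸ 3))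

Cat : ℕ → ℕ
Cat m = ((2 * m) C m) / suc m

-- Put n = 2k - 3 = 2p + 1. The elements of E_(n+1) are 2^n + r with r < 2^n, and 2^n + r is a
-- Dyck number iff r, read as an n-bit word, is balanced: each of its suffixes has at least as many
-- 1's as 0's (the leading 1 then makes the whole word fair). The elements of μ_(2k) are 2^(n+2) + r,
-- with binary form 100 followed by r, and such a number is Dyck iff r is balanced and has at least
-- p + 2 ones, enough to absorb the two extra 0's. A balanced word of odd length 2p + 1 has at least
-- p + 1 ones, so #E_(n+1) - #μ_(2k) is the number of balanced n-bit words with exactly p + 1 ones.
-- Splitting by the top digit gives the ballot recursion, whence this number is
-- C(n, p+1) - C(n, p+2) = Cat(p + 1).

module Submission where

open import Defs
open import Data.Bool using (Bool; false; true; T; not; _∧_)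
open import Data.Bool.Properties using (∧-assoc; ∧-comm; ∧-identityʳ; T-∧)
open import Data.Empty using (⊥-elim)
open import Data.List using ([]; _∷_; [_]; _++_; upTo; applyUpTo; filter; length; map)
open import Data.List.Properties using (map-++; upTo-∷ʳ)
open import Data.List.Relation.Unary.All using (all?)
open import Data.Nat
open import Data.Nat.Combinatorics using (_C_; nCk+nC[k+1]≡[n+1]C[k+1]; nCk≡nC[n∸k]; nC1≡n)
open import Data.Nat.DivMod
open import Data.Nat.Divisibility using (divides)
open import Data.Nat.ListAction using (sum)
open import Data.Nat.ListAction.Properties using (sum-++)
open import Data.Nat.Properties
open import Algebra.Properties.CommutativeSemigroup +-commutativeSemigroup using (xy∙z≈xz∙y; interchange)
open import Data.Nat.Tactic.RingSolver using (solve-∀)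
open import Data.Product using (_,_; proj₂)
open import Data.Sum using (inj₁; inj₂)
open import Data.Unit using (tt)
open import Function using (_∘_; id)
open import Function.Bundles using (Equivalence)
open import Relation.Nullary using (yes; no; does; ¬_; contradiction)
open import Relation.Unary using (Pred; Decidable)
open import Relation.Binary.PropositionalEquality hiding ([_])

T-injective : ∀ {a b} → (T a → T b) → (T b → T a) → a ≡ b
T-injective {false} {false} _ _ = refl
T-injective {false} {true}  _ b⇒a = ⊥-elim (b⇒a tt)
T-injective {true}  {false} a⇒b _ = ⊥-elim (a⇒b tt)
T-injective {true}  {true}  _ _ = refl

∧-redundantʳ : ∀ {b c} → (T b → T c) → b ∧ c ≡ b
∧-redundantʳ {false} _   = refl
∧-redundantʳ {true}  b⇒c = T-injective (λ _ → tt) (λ _ → b⇒c tt)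

∧-dropMiddle : ∀ b {c d} → (T d → T c) → (b ∧ c) ∧ d ≡ b ∧ d
∧-dropMiddle b {c} {d} d⇒c = begin
  (b ∧ c) ∧ d ≡⟨ ∧-assoc b c d ⟩
  b ∧ (c ∧ d) ≡⟨ cong (b ∧_) (∧-comm c d) ⟩
  b ∧ (d ∧ c) ≡⟨ cong (b ∧_) (∧-redundantʳ d⇒c) ⟩
  b ∧ d       ∎
  where open ≡-Reasoning

∧-congˡ-T : ∀ {b c d} → (T b → c ≡ d) → b ∧ c ≡ b ∧ d
∧-congˡ-T {false} _   = refl
∧-congˡ-T {true}  c≡d = c≡d tt

T-not : ∀ {b} → ¬ T b → T (not b)
T-not {false} _  = tt
T-not {true}  ¬b = ¬b tt

T-not⁻¹ : ∀ {b} → T (not b) → ¬ T b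
T-not⁻¹ {false} _ ()

𝟙 : Bool → ℕ
𝟙 false = 0
𝟙 true  = 1

𝟙-split : ∀ b c → 𝟙 b ≡ 𝟙 (b ∧ c) + 𝟙 (b ∧ not c)
𝟙-split false c     = refl
𝟙-split true  false = refl
𝟙-split true  true  = refl

count : (ℕ → Bool) → ℕ → ℕ
count g zero    = 0
count g (suc N) = 𝟙 (g 0) + count (g ∘ suc) N

count-cong : ∀ {g h} N → (∀ x → x < N → g x ≡ h x) → count g N ≡ count h N
count-cong zero    _   = refl
count-cong (suc N) g≡h =
  cong₂ _+_ (cong 𝟙 (g≡h 0 z<s)) (count-cong N (λ x x< → g≡h (suc x) (s<s x<)))

count-none : ∀ {g} N → (∀ x → x < N → ¬ T (g x)) → count g N ≡ 0
count-none zero    _  = refl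
count-none {g} (suc N) ¬g with g 0 | ¬g 0 z<s
... | false | _   = count-none N (λ x x< → ¬g (suc x) (s<s x<))
... | true  | ¬g0 = ⊥-elim (¬g0 tt)

count-+ : ∀ g a b → count g (a + b) ≡ count g a + count (λ x → g (a + x)) b
count-+ g zero    b = refl
count-+ g (suc a) b = trans (cong (𝟙 (g 0) +_) (count-+ (g ∘ suc) a b)) (sym (+-assoc (𝟙 (g 0)) _ _))

count-split : ∀ g h N → count g N ≡ count (λ x → g x ∧ h x) N + count (λ x → g x ∧ not (h x)) N
count-split g h zero    = refl
count-split g h (suc N) =
  trans (cong₂ _+_ (𝟙-split (g 0) (h 0)) (count-split (g ∘ suc) (h ∘ suc) N))
        (interchange (𝟙 (g 0 ∧ h 0)) (𝟙 (g 0 ∧ not (h 0))) _ _)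

length-filter-map-applyUpTo : ∀ {p} {P : Pred ℕ p} (P? : Decidable P) (f g : ℕ → ℕ) N →
  length (filter P? (map f (applyUpTo g N))) ≡ count (λ x → does (P? (f (g x)))) N
length-filter-map-applyUpTo P? f g zero = refl
length-filter-map-applyUpTo P? f g (suc N) with does (P? (f (g 0)))
... | false = length-filter-map-applyUpTo P? f (g ∘ suc) N
... | true  = cong suc (length-filter-map-applyUpTo P? f (g ∘ suc) N)

does-all?-++ : ∀ {p} {P : Pred ℕ p} (P? : Decidable P) xs ys →
  does (all? P? (xs ++ ys)) ≡ does (all? P? xs) ∧ does (all? P? ys)
does-all?-++ P? []       ys = refl
does-all?-++ P? (x ∷ xs) ys =
  trans (cong (does (P? x) ∧_) (does-all?-++ P? xs ys)) (sym (∧-assoc (does (P? x)) _ _))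

m+m≤n+n⇒m≤n : ∀ {m n} → m + m ≤ n + n → m ≤ n
m+m≤n+n⇒m≤n {m} {n} 2m≤2n with m ≤? n
... | yes m≤n = m≤n
... | no  m≰n = contradiction 2m≤2n (<⇒≱ (+-mono-< (≰⇒> m≰n) (≰⇒> m≰n)))

[2*x∸1]∸[x∸1]≡x : ∀ x .{{_ : NonZero x}} → (2 * x ∸ 1) ∸ (x ∸ 1) ≡ x
[2*x∸1]∸[x∸1]≡x (suc y) = trans (m+n∸m≡n y (suc (y + 0))) (cong suc (+-identityʳ y))

[1+k]*[1+n]C[1+k]≡[1+n]*nCk : ∀ n k → suc k * (suc n C suc k) ≡ suc n * (n C k)
[1+k]*[1+n]C[1+k]≡[1+n]*nCk n       zero    =
  trans (+-identityʳ _) (trans (nC1≡n (suc n)) (sym (*-identityʳ (suc n))))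
[1+k]*[1+n]C[1+k]≡[1+n]*nCk zero    (suc k) = *-zeroʳ (suc (suc k))
[1+k]*[1+n]C[1+k]≡[1+n]*nCk (suc n) (suc k) = begin
  suc (suc k) * (suc (suc n) C suc (suc k))
    ≡⟨ cong (suc (suc k) *_) (nCk+nC[k+1]≡[n+1]C[k+1] (suc n) (suc k)) ⟨
  suc (suc k) * (a + b)                     ≡⟨ expand (suc k) a b ⟩
  a + suc k * a + suc (suc k) * b
    ≡⟨ cong₂ (λ u v → a + u + v) ([1+k]*[1+n]C[1+k]≡[1+n]*nCk n k)
                                  ([1+k]*[1+n]C[1+k]≡[1+n]*nCk n (suc k)) ⟩
  a + suc n * (n C k) + suc n * (n C suc k) ≡⟨ +-assoc a _ _ ⟩
  a + (suc n * (n C k) + suc n * (n C suc k)) ≡⟨ cong (a +_) (*-distribˡ-+ (suc n) (n C k) (n C suc k)) ⟨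
  a + suc n * (n C k + n C suc k)
    ≡⟨ cong (λ u → a + suc n * u) (nCk+nC[k+1]≡[n+1]C[k+1] n k) ⟩
  a + suc n * a                             ∎
  where
  open ≡-Reasoning
  a = suc n C suc k
  b = suc n C suc (suc k)
  expand : ∀ m a b → suc m * (a + b) ≡ a + m * a + suc m * b
  expand = solve-∀

-- Binary digits

c*2^[1+n]≡c*2^n*2 : ∀ c n → c * 2 ^ suc n ≡ c * 2 ^ n * 2
c*2^[1+n]≡c*2^n*2 c n = trans (cong (c *_) (*-comm 2 (2 ^ n))) (sym (*-assoc c (2 ^ n) 2))

[c*2^[1+n]+r]/2≡c*2^n+r/2 : ∀ c n r → (c * 2 ^ suc n + r) / 2 ≡ c * 2 ^ n + r / 2
[c*2^[1+n]+r]/2≡c*2^n+r/2 c n r = begin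
  (c * 2 ^ suc n + r) / 2      ≡⟨ cong (λ x → (x + r) / 2) (c*2^[1+n]≡c*2^n*2 c n) ⟩
  (c * 2 ^ n * 2 + r) / 2      ≡⟨ +-distrib-/-∣ˡ r (divides (c * 2 ^ n) refl) ⟩
  c * 2 ^ n * 2 / 2 + r / 2    ≡⟨ cong (_+ r / 2) (m*n/n≡m (c * 2 ^ n) 2) ⟩
  c * 2 ^ n + r / 2            ∎
  where open ≡-Reasoning

[c*2^[1+n]+r]%2≡r%2 : ∀ c n r → (c * 2 ^ suc n + r) % 2 ≡ r % 2
[c*2^[1+n]+r]%2≡r%2 c n r = trans (cong (λ x → (x + r) % 2) (c*2^[1+n]≡c*2^n*2 c n))
  (%-remove-+ˡ r (divides (c * 2 ^ n) refl))

r<2^[1+n]⇒r/2<2^n : ∀ n {r} → r < 2 ^ suc n → r / 2 < 2 ^ n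
r<2^[1+n]⇒r/2<2^n n {r} r< = m<n*o⇒m/o<n (subst (r <_) (*-comm 2 (2 ^ n)) r<)

bit-high : ∀ n c {r} k → r < 2 ^ n → bit (c * 2 ^ n + r) (n + k) ≡ bit c k
bit-high zero    c {zero} k z<s = cong (λ x → bit x k) (trans (+-identityʳ (c * 1)) (*-identityʳ c))
bit-high (suc n) c {r}    k r< =
  trans (cong (λ x → bit x (n + k)) ([c*2^[1+n]+r]/2≡c*2^n+r/2 c n r))
        (bit-high n c k (r<2^[1+n]⇒r/2<2^n n r<))

bit-low : ∀ n c {r k} → r < 2 ^ n → k < n → bit (c * 2 ^ n + r) k ≡ bit r k
bit-low (suc n) c {r} {zero}  r< _         = [c*2^[1+n]+r]%2≡r%2 c n r
bit-low (suc n) c {r} {suc k} r< (s≤s k<n) =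
  trans (cong (λ x → bit x k) ([c*2^[1+n]+r]/2≡c*2^n+r/2 c n r))
        (bit-low n c (r<2^[1+n]⇒r/2<2^n n r<) k<n)

ones-suc : ∀ t k → ones t (suc k) ≡ ones t k + bit t k
ones-suc t k = begin
  sum (map (bit t) (upTo (suc k)))         ≡⟨ cong (sum ∘ map (bit t)) (upTo-∷ʳ k) ⟨
  sum (map (bit t) (upTo k ++ [ k ]))      ≡⟨ cong sum (map-++ (bit t) (upTo k) [ k ]) ⟩
  sum (map (bit t) (upTo k) ++ [ bit t k ]) ≡⟨ sum-++ (map (bit t) (upTo k)) [ bit t k ] ⟩
  ones t k + (bit t k + 0)                 ≡⟨ cong (ones t k +_) (+-identityʳ (bit t k)) ⟩
  ones t k + bit t k                       ∎
  where open ≡-Reasoning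

ones-low : ∀ n c {r} k → r < 2 ^ n → k ≤ n → ones (c * 2 ^ n + r) k ≡ ones r k
ones-low n c     zero    r< _   = refl
ones-low n c {r} (suc k) r< k<n = begin
  ones (c * 2 ^ n + r) (suc k)                  ≡⟨ ones-suc _ k ⟩
  ones (c * 2 ^ n + r) k + bit (c * 2 ^ n + r) k
    ≡⟨ cong₂ _+_ (ones-low n c k r< (<⇒≤ k<n)) (bit-low n c r< k<n) ⟩
  ones r k + bit r k                            ≡⟨ ones-suc r k ⟨
  ones r (suc k)                                ∎
  where open ≡-Reasoning

ones-high : ∀ n c {r} k → r < 2 ^ n → ones (c * 2 ^ n + r) (k + n) ≡ ones c k + ones r n
ones-high n c     zero    r< = ones-low n c n r< ≤-refl
ones-high n c {r} (suc k) r< = begin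
  ones t (suc (k + n))               ≡⟨ ones-suc t (k + n) ⟩
  ones t (k + n) + bit t (k + n)
    ≡⟨ cong₂ _+_ (ones-high n c k r<) (trans (cong (bit t) (+-comm k n)) (bit-high n c k r<)) ⟩
  ones c k + ones r n + bit c k      ≡⟨ xy∙z≈xz∙y (ones c k) (ones r n) (bit c k) ⟩
  ones c k + bit c k + ones r n      ≡⟨ cong (_+ ones r n) (ones-suc c k) ⟨
  ones c (suc k) + ones r n          ∎
  where
  open ≡-Reasoning
  t = c * 2 ^ n + r

ones-suc-below : ∀ n {r} → r < 2 ^ n → ones r (suc n) ≡ ones r n
ones-suc-below n r< = ones-high n 0 1 r<

2^n+r≡1*2^n+r : ∀ n r → 2 ^ n + r ≡ 1 * 2 ^ n + r
2^n+r≡1*2^n+r n r = cong (_+ r) (sym (*-identityˡ (2 ^ n)))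

ones-2^n+r : ∀ n {r} → r < 2 ^ n → ones (2 ^ n + r) (suc n) ≡ suc (ones r n)
ones-2^n+r n {r} r< = trans (cong (λ t → ones t (suc n)) (2^n+r≡1*2^n+r n r)) (ones-high n 1 1 r<)

0<2^m+r : ∀ m r → 0 < 2 ^ m + r
0<2^m+r m r = ≤-trans (m^n>0 2 m) (m≤m+n (2 ^ m) r)

bitLengthF-zero : ∀ f → bitLengthF f 0 ≡ 0
bitLengthF-zero zero    = refl
bitLengthF-zero (suc f) = refl

bitLengthF-suc : ∀ f t → 0 < t → bitLengthF (suc f) t ≡ suc (bitLengthF f (t / 2))
bitLengthF-suc f (suc t) _ = refl

bitLengthF-2^m+r : ∀ m {r f} → r < 2 ^ m → 2 ^ m + r ≤ f → bitLengthF f (2 ^ m + r) ≡ suc m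
bitLengthF-2^m+r zero    {zero} {suc f} z<s _  = cong suc (bitLengthF-zero f)
bitLengthF-2^m+r (suc m) {r}    {zero}  _  t≤ = contradiction t≤ (<⇒≱ (0<2^m+r (suc m) r))
bitLengthF-2^m+r (suc m) {r}    {suc f} r< t≤ = begin
  bitLengthF (suc f) t               ≡⟨ bitLengthF-suc f t 0<t ⟩
  suc (bitLengthF f (t / 2))         ≡⟨ cong (suc ∘ bitLengthF f) t/2≡ ⟩
  suc (bitLengthF f (2 ^ m + r / 2)) ≡⟨ cong suc (bitLengthF-2^m+r m (r<2^[1+n]⇒r/2<2^n m r<) fuel) ⟩
  suc (suc m)                        ∎
  where
  open ≡-Reasoning
  t = 2 ^ suc m + r
  0<t : 0 < t
  0<t = 0<2^m+r (suc m) r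
  t/2≡ : t / 2 ≡ 2 ^ m + r / 2
  t/2≡ = begin
    t / 2                   ≡⟨ cong (_/ 2) (2^n+r≡1*2^n+r (suc m) r) ⟩
    (1 * 2 ^ suc m + r) / 2 ≡⟨ [c*2^[1+n]+r]/2≡c*2^n+r/2 1 m r ⟩
    1 * 2 ^ m + r / 2       ≡⟨ 2^n+r≡1*2^n+r m (r / 2) ⟨
    2 ^ m + r / 2           ∎
  fuel : 2 ^ m + r / 2 ≤ f
  fuel = subst (_≤ f) t/2≡ (s≤s⁻¹ (≤-trans (m/n<m t 2 {{>-nonZero 0<t}} (s≤s (s≤s z≤n))) t≤))

bitLength-2^m+r : ∀ m {r} → r < 2 ^ m → bitLength (2 ^ m + r) ≡ suc m
bitLength-2^m+r m r< = bitLengthF-2^m+r m r< ≤-refl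

-- Balanced words and Dyck numbers

-- fair k o: a block of k bits containing o ones has at least as many 1's as 0's
fair : ℕ → ℕ → Bool
fair k o = k ≤ᵇ o + o

fair-suc : ∀ k o → T (fair k o) → T (fair (suc k) (suc o))
fair-suc k o h = ≤⇒≤ᵇ (s≤s (≤-trans (≤ᵇ⇒≤ k (o + o) h) (+-monoʳ-≤ o (n≤1+n o))))

fair-pred : ∀ k o → T (fair (suc k) o) → T (fair k o)
fair-pred k o h = ≤⇒≤ᵇ (<⇒≤ (≤ᵇ⇒≤ (suc k) (o + o) h))

balanced : ℕ → ℕ → Bool
balanced zero    t = true
balanced (suc n) t = balanced n t ∧ fair (suc n) (ones t (suc n))

balanced⇒fair : ∀ n t → T (balanced n t) → T (fair n (ones t n))
balanced⇒fair zero    t _ = tt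
balanced⇒fair (suc n) t h = proj₂ (Equivalence.to T-∧ h)

does-zeros≤?ones : ∀ t k → does (zeros t k ≤? ones t k) ≡ fair k (ones t k)
does-zeros≤?ones t k = T-injective
  (λ h → ≤⇒≤ᵇ (≤-trans (m≤n+m∸n k o) (+-monoʳ-≤ o (≤ᵇ⇒≤ (k ∸ o) o h))))
  (λ h → ≤⇒≤ᵇ (m≤n+o⇒m∸n≤o k o (≤ᵇ⇒≤ k (o + o) h)))
  where o = ones t k

does-all?-upTo : ∀ t L → does (all? (λ k → zeros t k ≤? ones t k) (upTo (suc L))) ≡ balanced L t
does-all?-upTo t zero    = refl
does-all?-upTo t (suc L) = begin
  does (all? P? (upTo (suc (suc L))))                  ≡⟨ cong (does ∘ all? P?) (upTo-∷ʳ (suc L)) ⟨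
  does (all? P? (upTo (suc L) ++ [ suc L ]))           ≡⟨ does-all?-++ P? (upTo (suc L)) [ suc L ] ⟩
  does (all? P? (upTo (suc L))) ∧ (does (P? (suc L)) ∧ true)
    ≡⟨ cong₂ _∧_ (does-all?-upTo t L) (trans (∧-identityʳ _) (does-zeros≤?ones t (suc L))) ⟩
  balanced (suc L) t                                   ∎
  where
  open ≡-Reasoning
  P? = λ k → zeros t k ≤? ones t k

dyck?≡balanced : ∀ {t L} → bitLength t ≡ L → does (dyck? t) ≡ balanced L t
dyck?≡balanced {t} refl = does-all?-upTo t (bitLength t)

balanced-cong : ∀ n {t s} → (∀ k → k ≤ n → ones t k ≡ ones s k) → balanced n t ≡ balanced n s
balanced-cong zero    _  = refl
balanced-cong (suc n) t≈s =
  cong₂ _∧_ (balanced-cong n (λ k k≤n → t≈s k (m≤n⇒m≤1+n k≤n)))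
            (cong (fair (suc n)) (t≈s (suc n) ≤-refl))

balanced-low : ∀ n c {r} → r < 2 ^ n → balanced n (c * 2 ^ n + r) ≡ balanced n r
balanced-low n c r< = balanced-cong n (λ k k≤n → ones-low n c k r< k≤n)

balanced-2^n+r : ∀ n {r} → r < 2 ^ n → balanced n (2 ^ n + r) ≡ balanced n r
balanced-2^n+r n {r} r< = trans (cong (balanced n) (2^n+r≡1*2^n+r n r)) (balanced-low n 1 r<)

countDyck≡count : ∀ a b → countDyck a b ≡ count (λ x → does (dyck? (suc a + x))) (b ∸ a)
countDyck≡count a b = length-filter-map-applyUpTo dyck? (suc a +_) id (b ∸ a)

countDyck-from-2^m : ∀ m b →
  countDyck (2 ^ m ∸ 1) b ≡ count (λ x → does (dyck? (2 ^ m + x))) (b ∸ (2 ^ m ∸ 1))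
countDyck-from-2^m m b = trans (countDyck≡count (2 ^ m ∸ 1) b)
  (cong (λ a → count (λ x → does (dyck? (a + x))) (b ∸ (2 ^ m ∸ 1)))
        (suc-pred (2 ^ m) {{m^n≢0 2 m}}))

dyck?-2^n+r : ∀ n {r} → r < 2 ^ n → does (dyck? (2 ^ n + r)) ≡ balanced n r
dyck?-2^n+r n {r} r< = begin
  does (dyck? (2 ^ n + r))                                  ≡⟨ dyck?≡balanced (bitLength-2^m+r n r<) ⟩
  balanced n (2 ^ n + r) ∧ fair (suc n) (ones (2 ^ n + r) (suc n))
    ≡⟨ cong₂ _∧_ (balanced-2^n+r n r<) (cong (fair (suc n)) (ones-2^n+r n r<)) ⟩
  balanced n r ∧ fair (suc n) (suc (ones r n))
    ≡⟨ ∧-redundantʳ (fair-suc n (ones r n) ∘ balanced⇒fair n r) ⟩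
  balanced n r                                              ∎
  where open ≡-Reasoning

2^[2+n]≡4*2^n : ∀ n → 2 ^ (2 + n) ≡ 4 * 2 ^ n
2^[2+n]≡4*2^n n = sym (*-assoc 2 2 (2 ^ n))

-- balanced-00 n r: r stays balanced when two 0's are put on top of its n digits
balanced-00 : ℕ → ℕ → Bool
balanced-00 n r = balanced n r ∧ fair (2 + n) (ones r n)

-- 2 ^ (2 + n) + r has binary digits 100 followed by the n digits of r
dyck?-2^[2+n]+r : ∀ n {r} → r < 2 ^ n → does (dyck? (2 ^ (2 + n) + r)) ≡ balanced-00 n r
dyck?-2^[2+n]+r n {r} r< = begin
  does (dyck? (2 ^ (2 + n) + r))
    ≡⟨ dyck?≡balanced (bitLength-2^m+r (2 + n) (<-≤-trans r< (^-monoʳ-≤ 2 (m≤n+m n 2)))) ⟩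
  balanced (3 + n) (2 ^ (2 + n) + r)
    ≡⟨ cong (λ t → balanced (3 + n) (t + r)) (2^[2+n]≡4*2^n n) ⟩
  balanced (3 + n) t
    ≡⟨ lower-digits ⟩
  ((balanced n r ∧ fair (1 + n) o) ∧ fair (2 + n) o) ∧ fair (3 + n) (suc o)
    ≡⟨ cong (_∧ fair (3 + n) (suc o)) (∧-dropMiddle (balanced n r) (fair-pred (1 + n) o)) ⟩
  (balanced n r ∧ fair (2 + n) o) ∧ fair (3 + n) (suc o)
    ≡⟨ ∧-redundantʳ (fair-suc (2 + n) o ∘ proj₂ ∘ Equivalence.to T-∧) ⟩
  balanced n r ∧ fair (2 + n) o
    ∎
  where
  open ≡-Reasoning
  t = 4 * 2 ^ n + r
  o = ones r n
  lower-digits : balanced (3 + n) t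
               ≡ ((balanced n r ∧ fair (1 + n) o) ∧ fair (2 + n) o) ∧ fair (3 + n) (suc o)
  lower-digits rewrite balanced-low n 4 r< | ones-high n 4 1 r< | ones-high n 4 2 r< | ones-high n 4 3 r< = refl

countDyck-level : ∀ n → countDyck (2 ^ n ∸ 1) (2 ^ suc n ∸ 1) ≡ count (balanced n) (2 ^ n)
countDyck-level n = begin
  countDyck (2 ^ n ∸ 1) (2 ^ suc n ∸ 1)
    ≡⟨ countDyck-from-2^m n (2 ^ suc n ∸ 1) ⟩
  count (λ x → does (dyck? (2 ^ n + x))) ((2 ^ suc n ∸ 1) ∸ (2 ^ n ∸ 1))
    ≡⟨ cong (count _) ([2*x∸1]∸[x∸1]≡x (2 ^ n) {{m^n≢0 2 n}}) ⟩
  count (λ x → does (dyck? (2 ^ n + x))) (2 ^ n)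
    ≡⟨ count-cong (2 ^ n) (λ x x< → dyck?-2^n+r n x<) ⟩
  count (balanced n) (2 ^ n)
    ∎
  where open ≡-Reasoning

countDyck-quarter : ∀ n → countDyck (2 ^ (2 + n) ∸ 1) (2 ^ (2 + n) ∸ 1 + 2 ^ n)
                        ≡ count (balanced-00 n) (2 ^ n)
countDyck-quarter n = begin
  countDyck a (a + 2 ^ n)
    ≡⟨ countDyck-from-2^m (2 + n) (a + 2 ^ n) ⟩
  count (λ x → does (dyck? (2 ^ (2 + n) + x))) (a + 2 ^ n ∸ a)
    ≡⟨ cong (count _) (m+n∸m≡n a (2 ^ n)) ⟩
  count (λ x → does (dyck? (2 ^ (2 + n) + x))) (2 ^ n)
    ≡⟨ count-cong (2 ^ n) (λ x x< → dyck?-2^[2+n]+r n x<) ⟩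
  count (balanced-00 n) (2 ^ n)
    ∎
  where
  open ≡-Reasoning
  a = 2 ^ (2 + n) ∸ 1

-- Ballot numbers

ballot : ℕ → ℕ → ℕ
ballot n j = count (λ r → balanced n r ∧ (ones r n ≡ᵇ j)) (2 ^ n)

ballot-zero : ∀ {n j} → j + j < n → ballot n j ≡ 0
ballot-zero {n} {j} 2j<n = count-none (2 ^ n) λ r _ h →
  let (bal , o≡ᵇj) = Equivalence.to T-∧ h
  in <⇒≱ 2j<n (subst (λ o → n ≤ o + o) (≡ᵇ⇒≡ (ones r n) j o≡ᵇj)
                     (≤ᵇ⇒≤ n _ (balanced⇒fair n r bal)))

-- split the (n+1)-bit words by their top digit
ballot-suc : ∀ {n i} → suc n ≤ suc i + suc i → ballot (suc n) (suc i) ≡ ballot n (suc i) + ballot n i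
ballot-suc {n} {i} 1+n≤2[1+i] = begin
  count g (2 ^ n + (2 ^ n + 0))                               ≡⟨ count-+ g (2 ^ n) (2 ^ n + 0) ⟩
  count g (2 ^ n) + count (λ x → g (2 ^ n + x)) (2 ^ n + 0)
    ≡⟨ cong₂ _+_ (count-cong (2 ^ n) top-digit-0)
                 (trans (cong (count _) (+-identityʳ (2 ^ n))) (count-cong (2 ^ n) top-digit-1)) ⟩
  ballot n (suc i) + ballot n i                               ∎
  where
  open ≡-Reasoning
  g : ℕ → Bool
  g r = balanced (suc n) r ∧ (ones r (suc n) ≡ᵇ suc i)
  fair-at : ∀ o → T (o ≡ᵇ suc i) → T (fair (suc n) o)
  fair-at o o≡ᵇ1+i =
    subst (T ∘ fair (suc n)) (sym (≡ᵇ⇒≡ o (suc i) o≡ᵇ1+i)) (≤⇒≤ᵇ 1+n≤2[1+i])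
  top-digit-0 : ∀ x → x < 2 ^ n → g x ≡ balanced n x ∧ (ones x n ≡ᵇ suc i)
  top-digit-0 x x< rewrite ones-suc-below n x< = ∧-dropMiddle (balanced n x) (fair-at (ones x n))
  top-digit-1 : ∀ x → x < 2 ^ n → g (2 ^ n + x) ≡ balanced n x ∧ (ones x n ≡ᵇ i)
  top-digit-1 x x< rewrite balanced-2^n+r n x< | ones-2^n+r n x< =
    ∧-dropMiddle (balanced n x) (fair-at (suc (ones x n)))

ballot+C≡C : ∀ n j → n ≤ suc (j + j) → ballot n j + n C suc j ≡ n C j
ballot+C≡C zero    zero    _ = refl
ballot+C≡C zero    (suc j) _ = refl
ballot+C≡C (suc n) j 1+n≤1+2j with m≤n⇒m<n∨m≡n 1+n≤1+2j
... | inj₂ refl = begin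
  ballot (suc (j + j)) j + suc (j + j) C suc j
    ≡⟨ cong (_+ suc (j + j) C suc j) (ballot-zero (n<1+n (j + j))) ⟩
  suc (j + j) C suc j                          ≡⟨ nCk≡nC[n∸k] (s≤s (m≤m+n j j)) ⟩
  suc (j + j) C (j + j ∸ j)                    ≡⟨ cong (suc (j + j) C_) (m+n∸n≡m j j) ⟩
  suc (j + j) C j                              ∎
  where open ≡-Reasoning
ballot+C≡C (suc n) zero    _ | inj₁ (s≤s ())
ballot+C≡C (suc n) (suc i) _ | inj₁ (s≤s 1+n≤2[1+i]) = begin
  ballot (suc n) (suc i) + suc n C suc (suc i)
    ≡⟨ cong₂ _+_ (ballot-suc 1+n≤2[1+i]) (sym (nCk+nC[k+1]≡[n+1]C[k+1] n (suc i))) ⟩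
  (ballot n (suc i) + ballot n i) + (n C suc i + n C suc (suc i))
    ≡⟨ regroup (ballot n (suc i)) (ballot n i) (n C suc i) (n C suc (suc i)) ⟩
  (ballot n i + n C suc i) + (ballot n (suc i) + n C suc (suc i))
    ≡⟨ cong₂ _+_ (ballot+C≡C n i n≤1+2i) (ballot+C≡C n (suc i) n≤3+2i) ⟩
  n C i + n C suc i
    ≡⟨ nCk+nC[k+1]≡[n+1]C[k+1] n i ⟩
  suc n C suc i ∎
  where
  open ≡-Reasoning
  n≤1+2i : n ≤ suc (i + i)
  n≤1+2i = subst (n ≤_) (+-suc i i) (s≤s⁻¹ 1+n≤2[1+i])
  n≤3+2i : n ≤ suc (suc i + suc i)
  n≤3+2i = ≤-trans n≤1+2i (m≤n⇒m≤1+n (s≤s (+-monoʳ-≤ i (n≤1+n i))))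
  regroup : ∀ a b c d → (a + b) + (c + d) ≡ (b + c) + (a + d)
  regroup = solve-∀

Cat≡ballot : ∀ p → Cat (suc p) ≡ ballot (suc (p + p)) (suc p)
Cat≡ballot p = begin
  ((2 * m) C m) / suc m ≡⟨ cong (_/ suc m) central ⟩
  (X + X) / suc m       ≡⟨ cong (_/ suc m) A*[1+m]≡X+X ⟨
  A * suc m / suc m     ≡⟨ m*n/n≡m A (suc m) ⟩
  A                     ∎
  where
  open ≡-Reasoning
  N = suc (p + p)
  m = suc p
  A = ballot N m
  X = N C m
  Y = N C suc m
  A+Y≡X : A + Y ≡ X
  A+Y≡X = ballot+C≡C N m (s≤s (+-mono-≤ (n≤1+n p) (n≤1+n p)))
  absorb : suc m * (X + Y) ≡ suc N * X
  absorb = trans (cong (suc m *_) (nCk+nC[k+1]≡[n+1]C[k+1] N m)) ([1+k]*[1+n]C[1+k]≡[1+n]*nCk N m)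
  central : (2 * m) C m ≡ X + X
  central = begin
    (2 * m) C m       ≡⟨ cong (_C m) (2*[1+p]≡2+2p p) ⟩
    suc N C m         ≡⟨ nCk+nC[k+1]≡[n+1]C[k+1] N p ⟨
    N C p + X         ≡⟨ cong (_+ X) X≡NCp ⟨
    X + X             ∎
    where
    2*[1+p]≡2+2p : ∀ p → 2 * suc p ≡ suc (suc (p + p))
    2*[1+p]≡2+2p = solve-∀
    X≡NCp : X ≡ N C p
    X≡NCp = trans (nCk≡nC[n∸k] (s≤s (m≤m+n p p))) (cong (N C_) (m+n∸n≡m p p))
  A*[1+m]≡X+X : A * suc m ≡ X + X
  A*[1+m]≡X+X = +-cancelʳ-≡ (suc N * X) _ _ (begin
    A * suc m + suc N * X           ≡⟨ cong (A * suc m +_) absorb ⟨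
    A * suc m + suc m * (X + Y)     ≡⟨ rearrange₁ A X Y m ⟩
    suc m * (A + Y) + suc m * X     ≡⟨ cong (λ x → suc m * x + suc m * X) A+Y≡X ⟩
    suc m * X + suc m * X           ≡⟨ rearrange₂ p X ⟩
    X + X + suc N * X               ∎)
    where
    rearrange₁ : ∀ A X Y m → A * suc m + suc m * (X + Y) ≡ suc m * (A + Y) + suc m * X
    rearrange₁ = solve-∀
    rearrange₂ : ∀ p X → suc (suc p) * X + suc (suc p) * X ≡ X + X + suc (suc (p + p)) * X
    rearrange₂ = solve-∀

-- A fair block of odd length 2p+1 has at least p+1 ones, and two further 0's keep it fair
-- unless it has exactly p+1.
fair-odd : ∀ p o → T (fair (suc (p + p)) o) → not (fair (3 + (p + p)) o) ≡ (o ≡ᵇ suc p)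
fair-odd p o fair-1+2p = T-injective
  (λ unfair → ≡⇒≡ᵇ o (suc p) (≤-antisym (o≤1+p (T-not⁻¹ unfair)) 1+p≤o))
  (λ o≡ᵇ1+p → T-not λ fair-3+2p →
    3+2p≰2+2p (subst (λ x → 3 + (p + p) ≤ x + x) (≡ᵇ⇒≡ o (suc p) o≡ᵇ1+p) (≤ᵇ⇒≤ _ _ fair-3+2p)))
  where
  2+2p≡[1+p]+[1+p] : suc (suc (p + p)) ≡ suc p + suc p
  2+2p≡[1+p]+[1+p] = cong suc (sym (+-suc p p))
  3+2p≰2+2p : ¬ 3 + (p + p) ≤ suc p + suc p
  3+2p≰2+2p h = 1+n≰n (subst (3 + (p + p) ≤_) (sym 2+2p≡[1+p]+[1+p]) h)
  1+p≤o : suc p ≤ o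
  1+p≤o with suc p ≤? o
  ... | yes 1+p≤o = 1+p≤o
  ... | no  1+p≰o = contradiction (≤ᵇ⇒≤ _ _ fair-1+2p) (<⇒≱ (s≤s (+-mono-≤ o≤p o≤p)))
    where o≤p = s≤s⁻¹ (≰⇒> 1+p≰o)
  o≤1+p : ¬ T (fair (3 + (p + p)) o) → o ≤ suc p
  o≤1+p unfair =
    m+m≤n+n⇒m≤n (subst (o + o ≤_) 2+2p≡[1+p]+[1+p] (s≤s⁻¹ (≰⇒> (unfair ∘ ≤⇒≤ᵇ))))

count-balanced-odd : ∀ p → let n = suc (p + p) in
  count (balanced n) (2 ^ n) ≡ count (balanced-00 n) (2 ^ n) + ballot n (suc p)
count-balanced-odd p = trans (count-split (balanced n) (λ r → fair (2 + n) (ones r n)) (2 ^ n))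
  (cong (count (balanced-00 n) (2 ^ n) +_) (count-cong (2 ^ n) λ r _ →
    ∧-congˡ-T (fair-odd p (ones r n) ∘ balanced⇒fair n r)))
  where n = suc (p + p)

-- The identity already holds for k = 2, so 3 ≤ k only serves to exclude k < 2.
mainTheorem4 : (k : ℕ) → 3 ≤ k →
    #μ (2 * k) + Cat (k ∸ 1) ≡ #E (2 * k ∸ 2)
mainTheorem4 (suc zero)    (s≤s ())
mainTheorem4 (suc (suc p)) _ = begin
  #μ (2 * suc (suc p)) + Cat (suc p)
    ≡⟨ cong₂ _+_ (trans #μ≡ (countDyck-quarter n)) (Cat≡ballot p) ⟩
  count (balanced-00 n) (2 ^ n) + ballot n (suc p)
    ≡⟨ count-balanced-odd p ⟨
  count (balanced n) (2 ^ n)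
    ≡⟨ countDyck-level n ⟨
  #E (suc n)
    ≡⟨ cong #E 2k∸2≡1+n ⟨
  #E (2 * suc (suc p) ∸ 2)
    ∎
  where
  open ≡-Reasoning
  n = suc (p + p)
  2k∸2≡1+n : 2 * suc (suc p) ∸ 2 ≡ suc n
  2k∸2≡1+n = trans (+-suc p _) (cong suc (trans (+-suc p _) (cong (suc ∘ (p +_)) (+-identityʳ p))))
  #μ≡ : #μ (2 * suc (suc p)) ≡ countDyck (2 ^ (2 + n) ∸ 1) (2 ^ (2 + n) ∸ 1 + 2 ^ n)
  #μ≡ = cong₂ (λ a b → countDyck (2 ^ a ∸ 1) (2 ^ a ∸ 1 + 2 ^ b))
              (cong suc 2k∸2≡1+n) (cong pred 2k∸2≡1+n)
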